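{- For all integers $n, k \geq 1$ with $n \geq k$, $$\sum_{k \le i \le n} \frac{s(n-1,i-1)\, S(i,k)}{i} = \frac{1}{n}\binom{n}{k} B_{n-k}^*.$$
   Context: $X^{\underline{n}} := X(X-1)\cdots(X-n+1)$. The (signed) Stirling numbers of the first kind $s(n,k)$ are defined by $X^{\underline{n}} = \sum_{k=0}^{n} s(n,k) X^k$, and the Stirling numbers of the second kind $S(n,k)$ by $X^n = \sum_{k=0}^{n} S(n,k) X^{\underline{k}}$ ($n\ge0$), with $s(n,k)=S(n,k)=0$ for $n<k$. The Bernoulli numbers of the second kind $B_n^*$ are defined by $\frac{t}{\log(1+t)} = \sum_{n\ge 0} B_n^* \frac{t^n}{n!}$ (equivalently $B_n^* = \int_0^1 x^{\underline{n}}\,dx$). -}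

module Defs where

open import Data.Nat as ℕ using (ℕ; zero; suc)
open import Data.Nat.Combinatorics as ℕ using (_C_)
open import Data.Integer as ℤ using (ℤ; +_)
open import Data.Rational using (ℚ; _/_; _+_; _*_; 0ℚ)

-- Signed Stirling numbers of the first kind s(n,k):
-- coefficients of x^k in the falling factorial x(x-1)...(x-n+1),
-- given by the recurrence  x^{(n+1)} = x^{(n)} * (x - n).
stirling1 : ℕ → ℕ → ℤ
stirling1 zero    zero    = + 1
stirling1 zero    (suc k) = + 0
stirling1 (suc n) zero    = + 0
stirling1 (suc n) (suc k) = stirling1 n k ℤ.- (+ n) ℤ.* stirling1 n (suc k)

-- Stirling numbers of the second kind S(n,k):
-- x^n = Σ_k S(n,k) x^{(k)}, via  x * x^{(k)} = x^{(k+1)} + k x^{(k)}.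
stirling2 : ℕ → ℕ → ℤ
stirling2 zero    zero    = + 1
stirling2 zero    (suc k) = + 0
stirling2 (suc n) zero    = + 0
stirling2 (suc n) (suc k) = stirling2 n k ℤ.+ (+ suc k) ℤ.* stirling2 n (suc k)

sumTo : ℕ → (ℕ → ℚ) → ℚ
sumTo zero    f = f 0
sumTo (suc n) f = sumTo n f + f (suc n)

-- Σ_{a ≤ i ≤ b} f i  (empty sum = 0 when b < a)
sumFromTo : ℕ → ℕ → (ℕ → ℚ) → ℚ
sumFromTo a b f = go a (suc b ℕ.∸ a)
  where
  go : ℕ → ℕ → ℚ
  go i zero    = 0ℚ
  go i (suc m) = f i + go (suc i) m

-- Bernoulli numbers of the second kind:
-- B*_n = ∫_0^1 x^{(n)} dx = Σ_k s(n,k) ∫_0^1 x^k dx = Σ_k s(n,k)/(k+1).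
bernoulli2 : ℕ → ℚ
bernoulli2 n = sumTo n (λ k → stirling1 n k / suc k)

-- The summand  s(n-1,i-1) S(i,k) / i  (only used for i ≥ k ≥ 1; value 0 at i = 0).
summand : ℕ → ℕ → ℕ → ℚ
summand n k zero    = 0ℚ
summand n k (suc j) = (stirling1 (n ℕ.∸ 1) j ℤ.* stirling2 (suc j) k) / suc j

-- The right-hand side  (1/n) binom(n,k) B*_{n-k}  (only used for n ≥ 1; value 0 at n = 0).
rhs : ℕ → ℕ → ℚ
rhs zero    k = 0ℚ
rhs (suc m) k = (+ (suc m ℕ.C k) / suc m) * bernoulli2 (suc m ℕ.∸ k)

{-# OPTIONS --safe #-}
module Submission where

open import Algebra.Bundles using (CommutativeSemiring; CommutativeRing)
open import Data.Nat as ℕ using (ℕ; zero; suc; _∸_; _≤_; _<_; z≤n; s≤s; _≤′_; ≤′-refl; ≤′-step)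
import Data.Nat.Properties as ℕ
open import Data.Nat.Combinatorics using (_C_; nCn≡1; nC1≡n; k>n⇒nCk≡0; nCk+nC[k+1]≡[n+1]C[k+1]; nCk≡nC[n∸k])
import Data.Nat.Tactic.RingSolver as ℕ-Solver
open import Data.Integer as ℤ using (ℤ; +_; 0ℤ)
import Data.Integer.Properties as ℤ
open import Data.Integer.Tactic.RingSolver using (solve-∀)
open import Data.Rational as ℚ using (ℚ; _/_; 0ℚ; 1ℚ)
import Data.Rational.Properties as ℚ
open import Data.Rational.Unnormalised as ℚᵘ using (mkℚᵘ; *≡*)
import Data.Rational.Unnormalised.Properties as ℚᵘ
open import Data.Sum using (inj₁; inj₂)
open import Relation.Binary.PropositionalEquality as ≡ using (_≡_)
open import Defs

-- Write n = m + 1 and k = k′ + 1.  Multiplying the left-hand side by k, the identities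
-- k S(p+1,k) = Σ_{j≤p} C(p+1,j) S(j,k′) and C(p+1,j)/(p+1) = C(p,j)/(p+1-j) turn it into
-- Σ_l (1/(l+1)) Σ_j S(j,k′) s(m,j+l) C(j+l,j).  As s(m,j+l) C(j+l,j) is the coefficient of
-- y^j z^l in the falling factorial (y+z)^{\underline m}, the inner sum is its coefficient of
-- y^{\underline k′} z^l, which Vandermonde's identity gives as C(m,k′) s(m-k′,l).  Hence
-- k·LHS = C(m,k′) Σ_l s(m-k′,l)/(l+1) = C(m,k′) B*_{m-k′}, and k C(m+1,k) = (m+1) C(m,k′).

module FiniteSums {c ℓ} (R : CommutativeSemiring c ℓ) where

  open CommutativeSemiring R
  open import Algebra.Properties.CommutativeSemigroup +-commutativeSemigroup using (interchange)
  open import Relation.Binary.Reasoning.Setoid setoid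

  ∑≤ : ℕ → (ℕ → Carrier) → Carrier
  ∑≤ zero    f = f 0
  ∑≤ (suc n) f = ∑≤ n f + f (suc n)

  infix 6.5 ∑≤
  syntax ∑≤ n (λ i → x) = ∑[ i ≤ n ] x

  ∑-cong-≤ : ∀ n {f g} → (∀ i → i ≤ n → f i ≈ g i) → ∑≤ n f ≈ ∑≤ n g
  ∑-cong-≤ zero    f≈g = f≈g 0 ℕ.z≤n
  ∑-cong-≤ (suc n) f≈g =
    +-cong (∑-cong-≤ n (λ i i≤n → f≈g i (ℕ.m≤n⇒m≤1+n i≤n))) (f≈g (suc n) ℕ.≤-refl)

  ∑-cong : ∀ n {f g} → (∀ i → f i ≈ g i) → ∑≤ n f ≈ ∑≤ n g
  ∑-cong n f≈g = ∑-cong-≤ n (λ i _ → f≈g i)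

  ∑-zero : ∀ n {f} → (∀ i → f i ≈ 0#) → ∑≤ n f ≈ 0#
  ∑-zero zero    f≈0 = f≈0 0
  ∑-zero (suc n) f≈0 = trans (+-cong (∑-zero n f≈0) (f≈0 (suc n))) (+-identityʳ 0#)

  ∑-suc : ∀ n f → ∑≤ (suc n) f ≈ f 0 + ∑[ i ≤ n ] f (suc i)
  ∑-suc zero    f = refl
  ∑-suc (suc n) f = trans (+-congʳ (∑-suc n f)) (+-assoc _ _ _)

  ∑-distrib-+ : ∀ n f g → ∑[ i ≤ n ] (f i + g i) ≈ ∑≤ n f + ∑≤ n g
  ∑-distrib-+ zero    f g = refl
  ∑-distrib-+ (suc n) f g = trans (+-congʳ (∑-distrib-+ n f g)) (interchange _ _ _ _)

  *-distribˡ-∑ : ∀ n x f → x * ∑≤ n f ≈ ∑[ i ≤ n ] (x * f i)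
  *-distribˡ-∑ zero    x f = refl
  *-distribˡ-∑ (suc n) x f = trans (distribˡ x _ _) (+-congʳ (*-distribˡ-∑ n x f))

  ∑-comm : ∀ m n (f : ℕ → ℕ → Carrier) → ∑[ i ≤ m ] ∑[ j ≤ n ] f i j ≈ ∑[ j ≤ n ] ∑[ i ≤ m ] f i j
  ∑-comm zero    n f = refl
  ∑-comm (suc m) n f = trans (+-congʳ (∑-comm m n f)) (sym (∑-distrib-+ n _ (f (suc m))))

  ∑-extend : ∀ {m n} f → m ≤ n → (∀ i → m < i → f i ≈ 0#) → ∑≤ n f ≈ ∑≤ m f
  ∑-extend {m} f m≤n f≈0 = go (ℕ.≤⇒≤′ m≤n)
    where
    go : ∀ {n} → m ≤′ n → ∑≤ n f ≈ ∑≤ m f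
    go ≤′-refl         = refl
    go (≤′-step m≤′n) = trans (+-cong (go m≤′n) (f≈0 _ (s≤s (ℕ.≤′⇒≤ m≤′n)))) (+-identityʳ _)

  ∑-shift : ∀ m n f → (∀ i → i < m → f i ≈ 0#) → ∑≤ (m ℕ.+ n) f ≈ ∑[ i ≤ n ] f (m ℕ.+ i)
  ∑-shift zero    n f f≈0 = refl
  ∑-shift (suc m) n f f≈0 = begin
    ∑≤ (suc (m ℕ.+ n)) f                  ≈⟨ ∑-suc (m ℕ.+ n) f ⟩
    f 0 + ∑[ i ≤ m ℕ.+ n ] f (suc i)      ≈⟨ +-cong (f≈0 0 ℕ.z<s)
                                                    (∑-shift m n _ (λ i i<m → f≈0 (suc i) (s≤s i<m))) ⟩
    0# + ∑[ i ≤ n ] f (suc m ℕ.+ i)       ≈⟨ +-identityˡ _ ⟩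
    ∑[ i ≤ n ] f (suc m ℕ.+ i)            ∎

  ∑-triangle : ∀ n (f : ℕ → ℕ → Carrier) →
               ∑[ p ≤ n ] ∑[ j ≤ p ] f p j ≈ ∑[ j ≤ n ] ∑[ l ≤ n ∸ j ] f (j ℕ.+ l) j
  ∑-triangle zero    f = refl
  ∑-triangle (suc n) f = begin
    ∑[ p ≤ n ] ∑[ j ≤ p ] f p j + (∑[ j ≤ n ] f (suc n) j + f (suc n) (suc n))
      ≈⟨ trans (+-congʳ (∑-triangle n f)) (sym (+-assoc _ _ _)) ⟩
    ∑[ j ≤ n ] ∑[ l ≤ n ∸ j ] f (j ℕ.+ l) j + ∑[ j ≤ n ] f (suc n) j + f (suc n) (suc n)
      ≈⟨ +-cong (sym (∑-distrib-+ n _ _)) diagonal ⟩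
    ∑[ j ≤ n ] (∑[ l ≤ n ∸ j ] f (j ℕ.+ l) j + f (suc n) j) + ∑[ l ≤ suc n ∸ suc n ] f (suc n ℕ.+ l) (suc n)
      ≈⟨ +-congʳ (∑-cong-≤ n row) ⟩
    ∑[ j ≤ suc n ] ∑[ l ≤ suc n ∸ j ] f (j ℕ.+ l) j ∎
    where
    diagonal : f (suc n) (suc n) ≈ ∑[ l ≤ suc n ∸ suc n ] f (suc n ℕ.+ l) (suc n)
    diagonal rewrite ℕ.n∸n≡0 n = reflexive (≡.cong (λ p → f (suc p) (suc n)) (≡.sym (ℕ.+-identityʳ n)))
    row : ∀ j → j ≤ n → ∑[ l ≤ n ∸ j ] f (j ℕ.+ l) j + f (suc n) j ≈ ∑[ l ≤ suc n ∸ j ] f (j ℕ.+ l) j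
    row j j≤n rewrite ℕ.+-∸-assoc 1 j≤n =
      +-congˡ (reflexive (≡.cong (λ p → f p j) (≡.sym j+[1+n∸j]≡1+n)))
      where
      j+[1+n∸j]≡1+n = ≡.trans (ℕ.+-suc j (n ∸ j)) (≡.cong suc (ℕ.m+[n∸m]≡n j≤n))

open ≡ using (refl; sym; trans; cong; cong₂; module ≡-Reasoning)
open ≡-Reasoning

module ℤ∑ = FiniteSums ℤ.+-*-commutativeSemiring

[k+1]*[n+1]C[k+1]≡[n+1]*nCk : ∀ n k → suc k ℕ.* (suc n C suc k) ≡ suc n ℕ.* (n C k)
[k+1]*[n+1]C[k+1]≡[n+1]*nCk zero    zero    = refl
[k+1]*[n+1]C[k+1]≡[n+1]*nCk zero    (suc k) = ℕ.*-zeroʳ (suc (suc k))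
[k+1]*[n+1]C[k+1]≡[n+1]*nCk (suc n) zero    =
  trans (ℕ.+-identityʳ _) (trans (nC1≡n (suc (suc n))) (sym (ℕ.*-identityʳ (suc (suc n)))))
[k+1]*[n+1]C[k+1]≡[n+1]*nCk (suc n) (suc k) = begin
  suc (suc k) ℕ.* (suc (suc n) C suc (suc k))
    ≡⟨ cong (suc (suc k) ℕ.*_) (sym (nCk+nC[k+1]≡[n+1]C[k+1] (suc n) (suc k))) ⟩
  suc (suc k) ℕ.* (a ℕ.+ b)
    ≡⟨ regroup (suc n C suc k) (suc n C suc (suc k)) k ⟩
  a ℕ.+ (suc k ℕ.* a ℕ.+ suc (suc k) ℕ.* b)
    ≡⟨ cong₂ (λ x y → a ℕ.+ (x ℕ.+ y)) ([k+1]*[n+1]C[k+1]≡[n+1]*nCk n k)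
                                        ([k+1]*[n+1]C[k+1]≡[n+1]*nCk n (suc k)) ⟩
  a ℕ.+ (suc n ℕ.* (n C k) ℕ.+ suc n ℕ.* (n C suc k))
    ≡⟨ cong (a ℕ.+_) (sym (ℕ.*-distribˡ-+ (suc n) (n C k) (n C suc k))) ⟩
  a ℕ.+ suc n ℕ.* (n C k ℕ.+ n C suc k)
    ≡⟨ cong (λ x → a ℕ.+ suc n ℕ.* x) (nCk+nC[k+1]≡[n+1]C[k+1] n k) ⟩
  suc (suc n) ℕ.* a ∎
  where
  a = suc n C suc k
  b = suc n C suc (suc k)
  regroup : ∀ a b k → suc (suc k) ℕ.* (a ℕ.+ b) ≡ a ℕ.+ (suc k ℕ.* a ℕ.+ suc (suc k) ℕ.* b)
  regroup = ℕ-Solver.solve-∀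

[l+1]*[j+l+1]Cj≡[j+l+1]*[j+l]Cj : ∀ j l → suc l ℕ.* (suc (j ℕ.+ l) C j) ≡ suc (j ℕ.+ l) ℕ.* ((j ℕ.+ l) C j)
[l+1]*[j+l+1]Cj≡[j+l+1]*[j+l]Cj j l = begin
  suc l ℕ.* (suc (j ℕ.+ l) C j)
    ≡⟨ cong (suc l ℕ.*_) (trans (nCk≡nC[n∸k] (ℕ.m≤n⇒m≤1+n j≤j+l)) (cong (suc (j ℕ.+ l) C_) [1+j+l]∸j≡1+l)) ⟩
  suc l ℕ.* (suc (j ℕ.+ l) C suc l)
    ≡⟨ [k+1]*[n+1]C[k+1]≡[n+1]*nCk (j ℕ.+ l) l ⟩
  suc (j ℕ.+ l) ℕ.* ((j ℕ.+ l) C l)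
    ≡⟨ cong (suc (j ℕ.+ l) ℕ.*_) (sym (trans (nCk≡nC[n∸k] j≤j+l) (cong ((j ℕ.+ l) C_) (ℕ.m+n∸m≡n j l)))) ⟩
  suc (j ℕ.+ l) ℕ.* ((j ℕ.+ l) C j) ∎
  where
  j≤j+l = ℕ.m≤m+n j l
  [1+j+l]∸j≡1+l : suc (j ℕ.+ l) ∸ j ≡ suc l
  [1+j+l]∸j≡1+l = trans (ℕ.+-∸-assoc 1 j≤j+l) (cong suc (ℕ.m+n∸m≡n j l))

module _ where

  open import Data.Integer using (_+_; _*_; _-_; -_)
  open ℤ∑

  prev : (ℕ → ℤ) → ℕ → ℤ
  prev f zero    = 0ℤ
  prev f (suc n) = f n

  prev-cong : ∀ {f g} → (∀ i → f i ≡ g i) → ∀ n → prev f n ≡ prev g n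
  prev-cong f≡g zero    = refl
  prev-cong f≡g (suc n) = f≡g n

  prev-zero : ∀ n → prev (λ _ → 0ℤ) n ≡ 0ℤ
  prev-zero zero    = refl
  prev-zero (suc n) = refl

  prev-suc : ∀ (f : ℕ → ℤ) → f 0 ≡ 0ℤ → ∀ n → prev (λ i → f (suc i)) n ≡ f n
  prev-suc f f0≡0 zero    = sym f0≡0
  prev-suc f f0≡0 (suc n) = refl

  *-prev : ∀ a (f : ℕ → ℤ) n → a * prev f n ≡ prev (λ i → a * f i) n
  *-prev a f zero    = ℤ.*-zeroʳ a
  *-prev a f (suc n) = refl

  prev-* : ∀ (f : ℕ → ℤ) n a → prev f n * a ≡ prev (λ i → f i * a) n
  prev-* f zero    a = refl
  prev-* f (suc n) a = refl

  ∑-prev : ∀ m (f : ℕ → ℕ → ℤ) n → ∑[ j ≤ m ] prev (f j) n ≡ prev (λ i → ∑[ j ≤ m ] f j i) n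
  ∑-prev m f zero    = ∑-zero m {λ _ → 0ℤ} (λ _ → refl)
  ∑-prev m f (suc n) = refl

  -- Opaque, so that unification never unfolds n C k.
  opaque
    binomial : ℕ → ℕ → ℤ
    binomial n k = + (n C k)

    binomial≡nCk : ∀ n k → binomial n k ≡ + (n C k)
    binomial≡nCk n k = refl

    binomial[n,0]≡1 : ∀ n → binomial n 0 ≡ + 1
    binomial[n,0]≡1 n = refl

    binomial[n,n]≡1 : ∀ n → binomial n n ≡ + 1
    binomial[n,n]≡1 n = cong +_ (nCn≡1 n)

    n<k⇒binomial≡0 : ∀ {n k} → n < k → binomial n k ≡ 0ℤ
    n<k⇒binomial≡0 n<k = cong +_ (k>n⇒nCk≡0 n<k)

    binomial-rec : ∀ n k → binomial (suc n) k ≡ prev (binomial n) k + binomial n k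
    binomial-rec n zero    = refl
    binomial-rec n (suc k) = cong +_ (sym (nCk+nC[k+1]≡[n+1]C[k+1] n k))

    [k+1]*binomial[n+1,k+1]≡[n+1]*binomial[n,k] : ∀ n k →
      + suc k * binomial (suc n) (suc k) ≡ + suc n * binomial n k
    [k+1]*binomial[n+1,k+1]≡[n+1]*binomial[n,k] n k =
      trans (sym (ℤ.pos-* (suc k) _)) (trans (cong +_ ([k+1]*[n+1]C[k+1]≡[n+1]*nCk n k)) (ℤ.pos-* (suc n) _))

    [l+1]*binomial[j+l+1,j]≡[j+l+1]*binomial[j+l,j] : ∀ j l →
      + suc l * binomial (suc (j ℕ.+ l)) j ≡ + suc (j ℕ.+ l) * binomial (j ℕ.+ l) j
    [l+1]*binomial[j+l+1,j]≡[j+l+1]*binomial[j+l,j] j l =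
      trans (sym (ℤ.pos-* (suc l) _))
            (trans (cong +_ ([l+1]*[j+l+1]Cj≡[j+l+1]*[j+l]Cj j l)) (ℤ.pos-* (suc (j ℕ.+ l)) _))

  stirling1-rec : ∀ n k → stirling1 (suc n) k ≡ prev (stirling1 n) k - + n * stirling1 n k
  stirling1-rec zero    zero    = refl
  stirling1-rec (suc n) zero    = sym (cong (_-_ 0ℤ) (ℤ.*-zeroʳ (+ suc n)))
  stirling1-rec n       (suc k) = refl

  stirling2-rec : ∀ n k → stirling2 (suc n) k ≡ prev (stirling2 n) k + + k * stirling2 n k
  stirling2-rec n zero    = refl
  stirling2-rec n (suc k) = refl

  n<k⇒stirling1≡0 : ∀ {n k} → n < k → stirling1 n k ≡ 0ℤ
  n<k⇒stirling1≡0 {zero}  {suc k} _         = refl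
  n<k⇒stirling1≡0 {suc n} {suc k} (s≤s n<k) =
    trans (cong₂ (λ a b → a - + n * b) (n<k⇒stirling1≡0 n<k) (n<k⇒stirling1≡0 (ℕ.m<n⇒m<1+n n<k)))
          (cong (_-_ 0ℤ) (ℤ.*-zeroʳ (+ n)))

  n<k⇒stirling2≡0 : ∀ {n k} → n < k → stirling2 n k ≡ 0ℤ
  n<k⇒stirling2≡0 {zero}  {suc k} _         = refl
  n<k⇒stirling2≡0 {suc n} {suc k} (s≤s n<k) =
    trans (cong₂ (λ a b → a + + suc k * b) (n<k⇒stirling2≡0 n<k) (n<k⇒stirling2≡0 (ℕ.m<n⇒m<1+n n<k)))
          (trans (ℤ.+-identityˡ _) (ℤ.*-zeroʳ (+ suc k)))

  -- Multiplying Σ_j g(j) y^j = Σ_k (Σ_j S(j,k) g(j)) y^{\underline k} by y, using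
  -- y · y^{\underline k} = y^{\underline{k+1}} + k y^{\underline k}.
  ∑stirling2*prev : ∀ B (g : ℕ → ℤ) k →
    ∑[ j ≤ suc B ] stirling2 j k * prev g j ≡
    prev (λ i → ∑[ j ≤ B ] stirling2 j i * g j) k + + k * (∑[ j ≤ B ] stirling2 j k * g j)
  ∑stirling2*prev B g k = begin
    ∑[ j ≤ suc B ] S j k * prev g j
      ≡⟨ ∑-suc B (λ j → S j k * prev g j) ⟩
    S 0 k * 0ℤ + ∑[ j ≤ B ] S (suc j) k * g j
      ≡⟨ trans (cong (_+ ∑[ j ≤ B ] S (suc j) k * g j) (ℤ.*-zeroʳ (S 0 k))) (ℤ.+-identityˡ _) ⟩
    ∑[ j ≤ B ] S (suc j) k * g j
      ≡⟨ ∑-cong B (λ j → trans (cong (_* g j) (stirling2-rec j k)) (distrib j)) ⟩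
    ∑[ j ≤ B ] (prev (λ i → S j i * g j) k + + k * (S j k * g j))
      ≡⟨ ∑-distrib-+ B (λ j → prev (λ i → S j i * g j) k) (λ j → + k * (S j k * g j)) ⟩
    ∑[ j ≤ B ] prev (λ i → S j i * g j) k + ∑[ j ≤ B ] + k * (S j k * g j)
      ≡⟨ cong₂ _+_ (∑-prev B (λ j i → S j i * g j) k) (sym (*-distribˡ-∑ B (+ k) (λ j → S j k * g j))) ⟩
    prev (λ i → ∑[ j ≤ B ] S j i * g j) k + + k * (∑[ j ≤ B ] S j k * g j) ∎
    where
    S = stirling2
    distrib : ∀ j → (prev (S j) k + + k * S j k) * g j ≡ prev (λ i → S j i * g j) k + + k * (S j k * g j)
    distrib j = trans (ℤ.*-distribʳ-+ (g j) (prev (S j) k) (+ k * S j k))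
                      (cong₂ _+_ (prev-* (S j) k (g j)) (ℤ.*-assoc (+ k) (S j k) (g j)))

  stirling2[1+n,1+k]≡∑stirling2*binomial : ∀ n k →
    stirling2 (suc n) (suc k) ≡ ∑[ j ≤ n ] stirling2 j k * binomial n j
  stirling2[1+n,1+k]≡∑stirling2*binomial zero k =
    trans (regroup (stirling2 0 k) (+ suc k)) (cong (stirling2 0 k *_) (sym (binomial[n,0]≡1 0)))
    where
    regroup : ∀ x c → x + c * 0ℤ ≡ x * + 1
    regroup = solve-∀
  stirling2[1+n,1+k]≡∑stirling2*binomial (suc n) k = sym (begin
    ∑[ j ≤ suc n ] S j k * binomial (suc n) j
      ≡⟨ ∑-cong (suc n) (λ j → trans (cong (S j k *_) (binomial-rec n j))
                                     (ℤ.*-distribˡ-+ (S j k) (prev (binomial n) j) (binomial n j))) ⟩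
    ∑[ j ≤ suc n ] (S j k * prev (binomial n) j + S j k * binomial n j)
      ≡⟨ ∑-distrib-+ (suc n) (λ j → S j k * prev (binomial n) j) (λ j → S j k * binomial n j) ⟩
    ∑[ j ≤ suc n ] S j k * prev (binomial n) j + ∑[ j ≤ suc n ] S j k * binomial n j
      ≡⟨ cong₂ _+_ (∑stirling2*prev n (binomial n) k)
                   (∑-extend (λ j → S j k * binomial n j) (ℕ.n≤1+n n) beyond) ⟩
    prev (λ i → ∑[ j ≤ n ] S j i * binomial n j) k + + k * (∑[ j ≤ n ] S j k * binomial n j)
      + ∑[ j ≤ n ] S j k * binomial n j
      ≡⟨ cong₂ (λ a b → a + + k * b + b) (prev-cong (λ i → sym (IH i)) k) (sym (IH k)) ⟩
    prev (λ i → S (suc n) (suc i)) k + + k * S (suc n) (suc k) + S (suc n) (suc k)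
      ≡⟨ cong (λ a → a + + k * S (suc n) (suc k) + S (suc n) (suc k)) (prev-suc (S (suc n)) refl k) ⟩
    S (suc n) k + + k * S (suc n) (suc k) + S (suc n) (suc k)
      ≡⟨ regroup (S (suc n) k) (+ k) (S (suc n) (suc k)) ⟩
    S (suc n) k + (+ 1 + + k) * S (suc n) (suc k) ∎)
    where
    S = stirling2
    IH = stirling2[1+n,1+k]≡∑stirling2*binomial n
    beyond : ∀ j → n < j → S j k * binomial n j ≡ 0ℤ
    beyond j n<j = trans (cong (S j k *_) (n<k⇒binomial≡0 n<j)) (ℤ.*-zeroʳ (S j k))
    regroup : ∀ a c b → a + c * b + b ≡ a + (+ 1 + c) * b
    regroup = solve-∀

  [1+k]*stirling2[1+p,1+k]≡∑stirling2*binomial : ∀ p k →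
    + suc k * stirling2 (suc p) (suc k) ≡ ∑[ j ≤ p ] stirling2 j k * binomial (suc p) j
  [1+k]*stirling2[1+p,1+k]≡∑stirling2*binomial p k = begin
    + suc k * S (suc p) (suc k)
      ≡⟨ add-sub (S (suc p) k) (+ suc k * S (suc p) (suc k)) ⟩
    S (suc (suc p)) (suc k) - S (suc p) k
      ≡⟨ cong (_- S (suc p) k) (stirling2[1+n,1+k]≡∑stirling2*binomial (suc p) k) ⟩
    Σp + S (suc p) k * binomial (suc p) (suc p) - S (suc p) k
      ≡⟨ cong (λ c → Σp + S (suc p) k * c - S (suc p) k) (binomial[n,n]≡1 (suc p)) ⟩
    Σp + S (suc p) k * + 1 - S (suc p) k
      ≡⟨ cancel Σp (S (suc p) k) ⟩
    Σp ∎
    where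
    S = stirling2
    Σp = ∑[ j ≤ p ] S j k * binomial (suc p) j
    add-sub : ∀ a b → b ≡ a + b - a
    add-sub = solve-∀
    cancel : ∀ a b → a + b * + 1 - b ≡ a
    cancel = solve-∀

  prev-pascal : ∀ (f : ℕ → ℤ) j l →
    prev f (j ℕ.+ l) * binomial (j ℕ.+ l) j ≡
    prev (λ i → f (i ℕ.+ l) * binomial (i ℕ.+ l) i) j + prev (λ i → f (j ℕ.+ i) * binomial (j ℕ.+ i) j) l
  prev-pascal f zero    zero    = refl
  prev-pascal f zero    (suc l) =
    trans (cong (f l *_) (trans (binomial[n,0]≡1 (suc l)) (sym (binomial[n,0]≡1 l)))) (sym (ℤ.+-identityˡ _))
  prev-pascal f (suc j) zero    rewrite ℕ.+-identityʳ j =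
    trans (cong (f j *_) (trans (binomial[n,n]≡1 (suc j)) (sym (binomial[n,n]≡1 j)))) (sym (ℤ.+-identityʳ _))
  prev-pascal f (suc j) (suc l) rewrite ℕ.+-suc j l =
    trans (cong (f (suc (j ℕ.+ l)) *_) (binomial-rec (suc (j ℕ.+ l)) (suc j)))
          (ℤ.*-distribˡ-+ (f (suc (j ℕ.+ l))) _ _)

  -- (y + z)^{\underline m} = Σ_{j,l} monomialCoeff m j l · y^j z^l
  --                       = Σ_{k,l} fallingCoeff m k l · y^{\underline k} z^l,
  -- and both recurrences below come from multiplying by y + z - m.
  monomialCoeff : ℕ → ℕ → ℕ → ℤ
  monomialCoeff m j l = stirling1 m (j ℕ.+ l) * binomial (j ℕ.+ l) j

  fallingCoeff : ℕ → ℕ → ℕ → ℤ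
  fallingCoeff m k l = binomial m k * stirling1 (m ∸ k) l

  monomialCoeff-rec : ∀ m j l → monomialCoeff (suc m) j l ≡
    prev (λ i → monomialCoeff m i l) j + prev (monomialCoeff m j) l - + m * monomialCoeff m j l
  monomialCoeff-rec m j l = begin
    stirling1 (suc m) (j ℕ.+ l) * c
      ≡⟨ cong (_* c) (stirling1-rec m (j ℕ.+ l)) ⟩
    (prev (stirling1 m) (j ℕ.+ l) - + m * stirling1 m (j ℕ.+ l)) * c
      ≡⟨ distrib (prev (stirling1 m) (j ℕ.+ l)) (+ m) (stirling1 m (j ℕ.+ l)) c ⟩
    prev (stirling1 m) (j ℕ.+ l) * c - + m * monomialCoeff m j l
      ≡⟨ cong (_- + m * monomialCoeff m j l) (prev-pascal (stirling1 m) j l) ⟩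
    prev (λ i → monomialCoeff m i l) j + prev (monomialCoeff m j) l - + m * monomialCoeff m j l ∎
    where
    c = binomial (j ℕ.+ l) j
    distrib : ∀ a M b c → (a - M * b) * c ≡ a * c - M * (b * c)
    distrib = solve-∀

  binomial*stirling1-rec : ∀ m k l → binomial m (suc k) * stirling1 (m ∸ k) l ≡
    prev (fallingCoeff m (suc k)) l + (+ suc k - + m) * fallingCoeff m (suc k) l
  binomial*stirling1-rec m k l with ℕ.≤-<-connex m k
  ... | inj₁ m≤k = begin
    c * stirling1 (m ∸ k) l
      ≡⟨ vanish (m ∸ k) l ⟩
    0ℤ
      ≡⟨ sym (cong₂ _+_ (prev-zero l) (ℤ.*-zeroʳ (+ suc k - + m))) ⟩
    prev (λ _ → 0ℤ) l + (+ suc k - + m) * 0ℤ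
      ≡⟨ sym (cong₂ (λ a b → a + (+ suc k - + m) * b) (prev-cong (vanish (m ∸ suc k)) l) (vanish (m ∸ suc k) l)) ⟩
    prev (fallingCoeff m (suc k)) l + (+ suc k - + m) * fallingCoeff m (suc k) l ∎
    where
    c = binomial m (suc k)
    vanish : ∀ n i → c * stirling1 n i ≡ 0ℤ
    vanish n i = cong (_* stirling1 n i) (n<k⇒binomial≡0 (s≤s m≤k))
  ... | inj₂ k<m = begin
    c * stirling1 (m ∸ k) l
      ≡⟨ cong (λ n → c * stirling1 n l) (ℕ.+-∸-assoc 1 k<m) ⟩
    c * stirling1 (suc d) l
      ≡⟨ cong (c *_) (stirling1-rec d l) ⟩
    c * (prev (stirling1 d) l - + d * stirling1 d l)
      ≡⟨ regroup c (prev (stirling1 d) l) (+ suc k) (+ d) (stirling1 d l) ⟩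
    c * prev (stirling1 d) l + (+ suc k - (+ suc k + + d)) * (c * stirling1 d l)
      ≡⟨ cong₂ (λ a b → a + (+ suc k - + b) * (c * stirling1 d l)) (*-prev c (stirling1 d) l) (ℕ.m+[n∸m]≡n k<m) ⟩
    prev (fallingCoeff m (suc k)) l + (+ suc k - + m) * fallingCoeff m (suc k) l ∎
    where
    c = binomial m (suc k)
    d = m ∸ suc k
    regroup : ∀ c a K D x → c * (a - D * x) ≡ c * a + (K - (K + D)) * (c * x)
    regroup = solve-∀

  fallingCoeff-rec : ∀ m k l → fallingCoeff (suc m) k l ≡
    prev (λ i → fallingCoeff m i l) k + prev (fallingCoeff m k) l + (+ k - + m) * fallingCoeff m k l
  fallingCoeff-rec m zero l = begin
    binomial (suc m) 0 * stirling1 (suc m) l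
      ≡⟨ cong₂ _*_ (trans (binomial[n,0]≡1 (suc m)) (sym (binomial[n,0]≡1 m))) (stirling1-rec m l) ⟩
    c * (prev (stirling1 m) l - + m * stirling1 m l)
      ≡⟨ regroup c (prev (stirling1 m) l) (+ m) (stirling1 m l) ⟩
    0ℤ + c * prev (stirling1 m) l + (0ℤ - + m) * (c * stirling1 m l)
      ≡⟨ cong (λ a → 0ℤ + a + (0ℤ - + m) * (c * stirling1 m l)) (*-prev c (stirling1 m) l) ⟩
    0ℤ + prev (fallingCoeff m 0) l + (0ℤ - + m) * fallingCoeff m 0 l ∎
    where
    c = binomial m 0
    regroup : ∀ c a M x → c * (a - M * x) ≡ 0ℤ + c * a + (0ℤ - M) * (c * x)
    regroup = solve-∀
  fallingCoeff-rec m (suc k) l = begin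
    binomial (suc m) (suc k) * stirling1 (m ∸ k) l
      ≡⟨ cong (_* stirling1 (m ∸ k) l) (binomial-rec m (suc k)) ⟩
    (binomial m k + binomial m (suc k)) * stirling1 (m ∸ k) l
      ≡⟨ ℤ.*-distribʳ-+ (stirling1 (m ∸ k) l) (binomial m k) (binomial m (suc k)) ⟩
    fallingCoeff m k l + binomial m (suc k) * stirling1 (m ∸ k) l
      ≡⟨ cong (_+_ (fallingCoeff m k l)) (binomial*stirling1-rec m k l) ⟩
    fallingCoeff m k l + (prev (fallingCoeff m (suc k)) l + (+ suc k - + m) * fallingCoeff m (suc k) l)
      ≡⟨ sym (ℤ.+-assoc (fallingCoeff m k l) _ _) ⟩
    fallingCoeff m k l + prev (fallingCoeff m (suc k)) l + (+ suc k - + m) * fallingCoeff m (suc k) l ∎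

  ∑stirling2*monomialCoeff≡fallingCoeff : ∀ {m B} → m ≤ B → ∀ k l →
    ∑[ j ≤ B ] stirling2 j k * monomialCoeff m j l ≡ fallingCoeff m k l
  ∑stirling2*monomialCoeff≡fallingCoeff {zero} {B} _ k l = begin
    ∑[ j ≤ B ] stirling2 j k * monomialCoeff 0 j l
      ≡⟨ ∑-extend {n = B} (λ j → stirling2 j k * monomialCoeff 0 j l) z≤n beyond ⟩
    stirling2 0 k * monomialCoeff 0 0 l
      ≡⟨ diagonal k ⟩
    fallingCoeff 0 k l ∎
    where
    beyond : ∀ j → 0 < j → stirling2 j k * monomialCoeff 0 j l ≡ 0ℤ
    beyond (suc j) _ = ℤ.*-zeroʳ (stirling2 (suc j) k)
    diagonal : ∀ k → stirling2 0 k * monomialCoeff 0 0 l ≡ fallingCoeff 0 k l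
    diagonal zero    = trans (cong (+ 1 *_) (trans (cong (stirling1 0 l *_) (binomial[n,0]≡1 l))
                                                   (ℤ.*-identityʳ (stirling1 0 l))))
                             (cong (_* stirling1 0 l) (sym (binomial[n,0]≡1 0)))
    diagonal (suc k) = sym (cong (_* stirling1 0 l) (n<k⇒binomial≡0 (s≤s z≤n)))
  ∑stirling2*monomialCoeff≡fallingCoeff {suc m} {suc B} (s≤s m≤B) k l = begin
    ∑[ j ≤ suc B ] S j k * V (suc m) j l
      ≡⟨ ∑-cong (suc B) expand ⟩
    ∑[ j ≤ suc B ] (S j k * prev (λ i → V m i l) j + prev (λ i → S j k * V m j i) l + - + m * (S j k * V m j l))
      ≡⟨ ∑-distrib-+₃ ⟩
    ∑[ j ≤ suc B ] S j k * prev (λ i → V m i l) j + ∑[ j ≤ suc B ] prev (λ i → S j k * V m j i) l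
      + ∑[ j ≤ suc B ] - + m * (S j k * V m j l)
      ≡⟨ cong₂ _+_ (cong₂ _+_ (∑stirling2*prev B (λ j → V m j l) k) (∑-prev (suc B) (λ j i → S j k * V m j i) l))
                   (sym (*-distribˡ-∑ (suc B) (- + m) (λ j → S j k * V m j l))) ⟩
    prev (λ i → ∑[ j ≤ B ] S j i * V m j l) k + + k * (∑[ j ≤ B ] S j k * V m j l)
      + prev (λ i → ∑[ j ≤ suc B ] S j k * V m j i) l + - + m * (∑[ j ≤ suc B ] S j k * V m j l)
      ≡⟨ cong₂ _+_ (cong₂ _+_ (cong₂ _+_ (prev-cong (λ i → IH i l) k) (cong (+ k *_) (IH k l)))
                              (prev-cong (IH′ k) l))
                   (cong (- + m *_) (IH′ k l)) ⟩
    prev (λ i → T m i l) k + + k * T m k l + prev (T m k) l + - + m * T m k l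
      ≡⟨ collect (prev (λ i → T m i l) k) (+ k) (T m k l) (prev (T m k) l) (+ m) ⟩
    prev (λ i → T m i l) k + prev (T m k) l + (+ k - + m) * T m k l
      ≡⟨ sym (fallingCoeff-rec m k l) ⟩
    T (suc m) k l ∎
    where
    S = stirling2
    V = monomialCoeff
    T = fallingCoeff
    IH  = ∑stirling2*monomialCoeff≡fallingCoeff m≤B
    IH′ = ∑stirling2*monomialCoeff≡fallingCoeff (ℕ.m≤n⇒m≤1+n m≤B)
    distrib : ∀ s a b M v → s * (a + b - M * v) ≡ s * a + s * b + - M * (s * v)
    distrib = solve-∀
    collect : ∀ P K t Q M → P + K * t + Q + - M * t ≡ P + Q + (K - M) * t
    collect = solve-∀
    expand : ∀ j → S j k * V (suc m) j l ≡
                   S j k * prev (λ i → V m i l) j + prev (λ i → S j k * V m j i) l + - + m * (S j k * V m j l)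
    expand j = begin
      S j k * V (suc m) j l
        ≡⟨ cong (S j k *_) (monomialCoeff-rec m j l) ⟩
      S j k * (prev (λ i → V m i l) j + prev (V m j) l - + m * V m j l)
        ≡⟨ distrib (S j k) (prev (λ i → V m i l) j) (prev (V m j) l) (+ m) (V m j l) ⟩
      S j k * prev (λ i → V m i l) j + S j k * prev (V m j) l + - + m * (S j k * V m j l)
        ≡⟨ cong (λ a → S j k * prev (λ i → V m i l) j + a + - + m * (S j k * V m j l)) (*-prev (S j k) (V m j) l) ⟩
      S j k * prev (λ i → V m i l) j + prev (λ i → S j k * V m j i) l + - + m * (S j k * V m j l) ∎
    ∑-distrib-+₃ : ∀ {a b c : ℕ → ℤ} →
                   ∑[ j ≤ suc B ] (a j + b j + c j) ≡ ∑≤ (suc B) a + ∑≤ (suc B) b + ∑≤ (suc B) c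
    ∑-distrib-+₃ {a} {b} {c} =
      trans (∑-distrib-+ (suc B) (λ j → a j + b j) c) (cong (_+ ∑≤ (suc B) c) (∑-distrib-+ (suc B) a b))

open import Data.Rational using (_+_; _*_)
open FiniteSums (CommutativeRing.commutativeSemiring ℚ.+-*-commutativeRing)

fromℚᵘ-homo-+ : ∀ p q → ℚ.fromℚᵘ (p ℚᵘ.+ q) ≡ ℚ.fromℚᵘ p + ℚ.fromℚᵘ q
fromℚᵘ-homo-+ p q = ℚ.toℚᵘ-injective (ℚᵘ.≃-trans (ℚ.toℚᵘ-fromℚᵘ (p ℚᵘ.+ q)) (ℚᵘ.≃-sym
  (ℚᵘ.≃-trans (ℚ.toℚᵘ-homo-+ (ℚ.fromℚᵘ p) (ℚ.fromℚᵘ q))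
              (ℚᵘ.+-cong (ℚ.toℚᵘ-fromℚᵘ p) (ℚ.toℚᵘ-fromℚᵘ q)))))

fromℚᵘ-homo-* : ∀ p q → ℚ.fromℚᵘ (p ℚᵘ.* q) ≡ ℚ.fromℚᵘ p * ℚ.fromℚᵘ q
fromℚᵘ-homo-* p q = ℚ.toℚᵘ-injective (ℚᵘ.≃-trans (ℚ.toℚᵘ-fromℚᵘ (p ℚᵘ.* q)) (ℚᵘ.≃-sym
  (ℚᵘ.≃-trans (ℚ.toℚᵘ-homo-* (ℚ.fromℚᵘ p) (ℚ.fromℚᵘ q))
              (ℚᵘ.*-cong (ℚ.toℚᵘ-fromℚᵘ p) (ℚ.toℚᵘ-fromℚᵘ q)))))

/-cross : ∀ a d b e → a ℤ.* + suc e ≡ b ℤ.* + suc d → a / suc d ≡ b / suc e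
/-cross a d b e eq = ℚ.fromℚᵘ-cong {mkℚᵘ a d} {mkℚᵘ b e} (*≡* eq)

/-distribʳ-+ : ∀ a b d → (a ℤ.+ b) / suc d ≡ a / suc d + b / suc d
/-distribʳ-+ a b d =
  trans (ℚ.fromℚᵘ-cong {mkℚᵘ (a ℤ.+ b) d} {mkℚᵘ a d ℚᵘ.+ mkℚᵘ b d} (*≡* eq))
        (fromℚᵘ-homo-+ (mkℚᵘ a d) (mkℚᵘ b d))
  where
  distrib : ∀ a b n → (a ℤ.+ b) ℤ.* (n ℤ.* n) ≡ (a ℤ.* n ℤ.+ b ℤ.* n) ℤ.* n
  distrib = solve-∀
  eq : (a ℤ.+ b) ℤ.* + (suc d ℕ.* suc d) ≡ (a ℤ.* + suc d ℤ.+ b ℤ.* + suc d) ℤ.* + suc d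
  eq = trans (cong ((a ℤ.+ b) ℤ.*_) (ℤ.pos-* (suc d) (suc d))) (distrib a b (+ suc d))

/-distribʳ-∑ : ∀ n f d → ℤ∑.∑≤ n f / suc d ≡ ∑[ i ≤ n ] f i / suc d
/-distribʳ-∑ zero    f d = refl
/-distribʳ-∑ (suc n) f d =
  trans (/-distribʳ-+ (ℤ∑.∑≤ n f) (f (suc n)) d) (cong (_+ f (suc n) / suc d) (/-distribʳ-∑ n f d))

[a/1]*[b/n]≡[a*b]/n : ∀ a b d → (a / 1) * (b / suc d) ≡ (a ℤ.* b) / suc d
[a/1]*[b/n]≡[a*b]/n a b d = begin
  (a / 1) * (b / suc d)
    ≡⟨ sym (fromℚᵘ-homo-* (mkℚᵘ a 0) (mkℚᵘ b d)) ⟩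
  ℚ.fromℚᵘ (mkℚᵘ a 0 ℚᵘ.* mkℚᵘ b d)
    ≡⟨ ℚ.fromℚᵘ-cong {mkℚᵘ a 0 ℚᵘ.* mkℚᵘ b d} {mkℚᵘ (a ℤ.* b) d} (*≡* eq) ⟩
  (a ℤ.* b) / suc d ∎
  where
  eq : (a ℤ.* b) ℤ.* + suc d ≡ (a ℤ.* b) ℤ.* + (1 ℕ.* suc d)
  eq = cong (λ n → (a ℤ.* b) ℤ.* + n) (sym (ℕ.*-identityˡ (suc d)))

[k+1]*x≡a*y⇒x≡[a/[k+1]]*y : ∀ k a {x y} → (+ suc k / 1) * x ≡ (a / 1) * y → x ≡ (a / suc k) * y
[k+1]*x≡a*y⇒x≡[a/[k+1]]*y k a {x} {y} eq = begin
  x                                     ≡⟨ sym (ℚ.*-identityˡ x) ⟩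
  1ℚ * x                                ≡⟨ cong (_* x) (sym inverse) ⟩
  (+ 1 / suc k) * (+ suc k / 1) * x     ≡⟨ ℚ.*-assoc (+ 1 / suc k) (+ suc k / 1) x ⟩
  (+ 1 / suc k) * ((+ suc k / 1) * x)   ≡⟨ cong ((+ 1 / suc k) *_) eq ⟩
  (+ 1 / suc k) * ((a / 1) * y)         ≡⟨ sym (ℚ.*-assoc (+ 1 / suc k) (a / 1) y) ⟩
  (+ 1 / suc k) * (a / 1) * y           ≡⟨ cong (_* y) (trans (ℚ.*-comm (+ 1 / suc k) (a / 1)) scale) ⟩
  (a / suc k) * y                       ∎
  where
  unit : ∀ c → c ℤ.* + 1 ℤ.* + 1 ≡ + 1 ℤ.* c
  unit = solve-∀
  inverse : (+ 1 / suc k) * (+ suc k / 1) ≡ 1ℚ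
  inverse = trans (ℚ.*-comm (+ 1 / suc k) (+ suc k / 1))
                  (trans ([a/1]*[b/n]≡[a*b]/n (+ suc k) (+ 1) k) (/-cross (+ suc k ℤ.* + 1) k (+ 1) 0 (unit (+ suc k))))
  scale : (a / 1) * (+ 1 / suc k) ≡ a / suc k
  scale = trans ([a/1]*[b/n]≡[a*b]/n a (+ 1) k) (cong (_/ suc k) (ℤ.*-identityʳ a))

binomial[m,k]/[k+1]≡[m+1]C[k+1]/[m+1] : ∀ m k → binomial m k / suc k ≡ + (suc m C suc k) / suc m
binomial[m,k]/[k+1]≡[m+1]C[k+1]/[m+1] m k = /-cross (binomial m k) k (+ (suc m C suc k)) m (begin
  binomial m k ℤ.* + suc m                ≡⟨ ℤ.*-comm (binomial m k) (+ suc m) ⟩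
  + suc m ℤ.* binomial m k                ≡⟨ sym ([k+1]*binomial[n+1,k+1]≡[n+1]*binomial[n,k] m k) ⟩
  + suc k ℤ.* binomial (suc m) (suc k)    ≡⟨ ℤ.*-comm (+ suc k) (binomial (suc m) (suc k)) ⟩
  binomial (suc m) (suc k) ℤ.* + suc k    ≡⟨ cong (ℤ._* + suc k) (binomial≡nCk (suc m) (suc k)) ⟩
  + (suc m C suc k) ℤ.* + suc k           ∎)

sumTo≡∑ : ∀ n f → sumTo n f ≡ ∑≤ n f
sumTo≡∑ zero    f = refl
sumTo≡∑ (suc n) f = cong (_+ f (suc n)) (sumTo≡∑ n f)

sumFromTo-step : ∀ {a b} f → a ≤ b → sumFromTo a b f ≡ f a + sumFromTo (suc a) b f
sumFromTo-step {a} {b} f a≤b with suc b ∸ a | ℕ.+-∸-assoc 1 a≤b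
... | .(suc (b ∸ a)) | refl = refl

sumFromTo-empty : ∀ b f → sumFromTo (suc b) b f ≡ 0ℚ
sumFromTo-empty b f with b ∸ b | ℕ.n∸n≡0 b
... | .0 | refl = refl

sumFromTo-+ : ∀ a d f → sumFromTo a (a ℕ.+ d) f ≡ ∑[ t ≤ d ] f (a ℕ.+ t)
sumFromTo-+ a zero f rewrite ℕ.+-identityʳ a = begin
  sumFromTo a a f                    ≡⟨ sumFromTo-step f ℕ.≤-refl ⟩
  f a + sumFromTo (suc a) a f        ≡⟨ cong (_+_ (f a)) (sumFromTo-empty a f) ⟩
  f a + 0ℚ                           ≡⟨ ℚ.+-identityʳ (f a) ⟩
  f a                                ∎
sumFromTo-+ a (suc d) f = begin
  sumFromTo a (a ℕ.+ suc d) f                ≡⟨ sumFromTo-step f (ℕ.m≤m+n a (suc d)) ⟩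
  f a + sumFromTo (suc a) (a ℕ.+ suc d) f    ≡⟨ cong (λ b → f a + sumFromTo (suc a) b f) (ℕ.+-suc a d) ⟩
  f a + sumFromTo (suc a) (suc a ℕ.+ d) f    ≡⟨ cong (_+_ (f a)) (sumFromTo-+ (suc a) d f) ⟩
  f a + ∑[ t ≤ d ] f (suc a ℕ.+ t)           ≡⟨ cong₂ _+_ (cong f (sym (ℕ.+-identityʳ a)))
                                                      (∑-cong d (λ t → cong f (sym (ℕ.+-suc a t)))) ⟩
  f (a ℕ.+ 0) + ∑[ t ≤ d ] f (a ℕ.+ suc t)   ≡⟨ sym (∑-suc d (λ t → f (a ℕ.+ t))) ⟩
  ∑[ t ≤ suc d ] f (a ℕ.+ t)                 ∎

sumFromTo≡∑ : ∀ {a b} f → a ≤ b → (∀ i → i < a → f i ≡ 0ℚ) → sumFromTo a b f ≡ ∑≤ b f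
sumFromTo≡∑ {a} {b} f a≤b f≡0 = begin
  sumFromTo a b f                 ≡⟨ cong (λ n → sumFromTo a n f) (sym a+[b∸a]≡b) ⟩
  sumFromTo a (a ℕ.+ (b ∸ a)) f   ≡⟨ sumFromTo-+ a (b ∸ a) f ⟩
  ∑[ t ≤ b ∸ a ] f (a ℕ.+ t)      ≡⟨ sym (∑-shift a (b ∸ a) f f≡0) ⟩
  ∑≤ (a ℕ.+ (b ∸ a)) f            ≡⟨ cong (λ n → ∑≤ n f) a+[b∸a]≡b ⟩
  ∑≤ b f                          ∎
  where
  a+[b∸a]≡b = ℕ.m+[n∸m]≡n a≤b

summand≡0 : ∀ n k i → i < k → summand n k i ≡ 0ℚ
summand≡0 n k zero    _   = refl
summand≡0 n k (suc j) j<k = begin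
  (stirling1 (n ∸ 1) j ℤ.* stirling2 (suc j) k) / suc j
    ≡⟨ cong (λ x → (stirling1 (n ∸ 1) j ℤ.* x) / suc j) (n<k⇒stirling2≡0 j<k) ⟩
  (stirling1 (n ∸ 1) j ℤ.* 0ℤ) / suc j
    ≡⟨ cong (_/ suc j) (ℤ.*-zeroʳ (stirling1 (n ∸ 1) j)) ⟩
  0ℤ / suc j
    ≡⟨ ℚ.0/n≡0 (suc j) ⟩
  0ℚ ∎

[k+1]*∑stirling1*stirling2/[p+1]≡∑monomialCoeff : ∀ m k →
  (+ suc k / 1) * (∑[ p ≤ m ] (stirling1 m p ℤ.* stirling2 (suc p) (suc k)) / suc p) ≡
  ∑[ l ≤ m ] (ℤ∑.∑[ j ≤ m ] stirling2 j k ℤ.* monomialCoeff m j l) / suc l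
[k+1]*∑stirling1*stirling2/[p+1]≡∑monomialCoeff m k = begin
  (+ suc k / 1) * (∑[ p ≤ m ] (s m p ℤ.* S (suc p) (suc k)) / suc p)
    ≡⟨ *-distribˡ-∑ m (+ suc k / 1) (λ p → (s m p ℤ.* S (suc p) (suc k)) / suc p) ⟩
  ∑[ p ≤ m ] (+ suc k / 1) * ((s m p ℤ.* S (suc p) (suc k)) / suc p)
    ≡⟨ ∑-cong m (λ p → trans ([a/1]*[b/n]≡[a*b]/n (+ suc k) (s m p ℤ.* S (suc p) (suc k)) p)
                             (cong (_/ suc p) (expand p))) ⟩
  ∑[ p ≤ m ] (ℤ∑.∑[ j ≤ p ] s m p ℤ.* (S j k ℤ.* binomial (suc p) j)) / suc p
    ≡⟨ ∑-cong m (λ p → /-distribʳ-∑ p (λ j → s m p ℤ.* (S j k ℤ.* binomial (suc p) j)) p) ⟩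
  ∑[ p ≤ m ] ∑[ j ≤ p ] (s m p ℤ.* (S j k ℤ.* binomial (suc p) j)) / suc p
    ≡⟨ ∑-triangle m (λ p j → (s m p ℤ.* (S j k ℤ.* binomial (suc p) j)) / suc p) ⟩
  ∑[ j ≤ m ] ∑[ l ≤ m ∸ j ] (s m (j ℕ.+ l) ℤ.* (S j k ℤ.* binomial (suc (j ℕ.+ l)) j)) / suc (j ℕ.+ l)
    ≡⟨ ∑-cong m (λ j → ∑-cong (m ∸ j) (reweigh j)) ⟩
  ∑[ j ≤ m ] ∑[ l ≤ m ∸ j ] (S j k ℤ.* V m j l) / suc l
    ≡⟨ ∑-cong m (λ j → sym (∑-extend (λ l → (S j k ℤ.* V m j l) / suc l) (ℕ.m∸n≤m m j) (beyond j))) ⟩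
  ∑[ j ≤ m ] ∑[ l ≤ m ] (S j k ℤ.* V m j l) / suc l
    ≡⟨ ∑-comm m m (λ j l → (S j k ℤ.* V m j l) / suc l) ⟩
  ∑[ l ≤ m ] ∑[ j ≤ m ] (S j k ℤ.* V m j l) / suc l
    ≡⟨ ∑-cong m (λ l → sym (/-distribʳ-∑ m (λ j → S j k ℤ.* V m j l) l)) ⟩
  ∑[ l ≤ m ] (ℤ∑.∑[ j ≤ m ] S j k ℤ.* V m j l) / suc l ∎
  where
  s = stirling1
  S = stirling2
  V = monomialCoeff
  swap : ∀ a b c → a ℤ.* (b ℤ.* c) ≡ b ℤ.* (a ℤ.* c)
  swap = solve-∀
  expand : ∀ p → + suc k ℤ.* (s m p ℤ.* S (suc p) (suc k)) ≡
                 ℤ∑.∑[ j ≤ p ] s m p ℤ.* (S j k ℤ.* binomial (suc p) j)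
  expand p = trans (swap (+ suc k) (s m p) (S (suc p) (suc k)))
                   (trans (cong (s m p ℤ.*_) ([1+k]*stirling2[1+p,1+k]≡∑stirling2*binomial p k))
                          (ℤ∑.*-distribˡ-∑ p (s m p) (λ j → S j k ℤ.* binomial (suc p) j)))
  regroup : ∀ x y c a → x ℤ.* (y ℤ.* c) ℤ.* a ≡ x ℤ.* y ℤ.* (a ℤ.* c)
  regroup = solve-∀
  regroup′ : ∀ x y b c → x ℤ.* y ℤ.* (b ℤ.* c) ≡ y ℤ.* (x ℤ.* c) ℤ.* b
  regroup′ = solve-∀
  reweigh : ∀ j l → (s m (j ℕ.+ l) ℤ.* (S j k ℤ.* binomial (suc (j ℕ.+ l)) j)) / suc (j ℕ.+ l) ≡
                    (S j k ℤ.* V m j l) / suc l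
  reweigh j l = /-cross (s m (j ℕ.+ l) ℤ.* (S j k ℤ.* binomial (suc (j ℕ.+ l)) j)) (j ℕ.+ l)
                        (S j k ℤ.* V m j l) l (begin
    s m (j ℕ.+ l) ℤ.* (S j k ℤ.* binomial (suc (j ℕ.+ l)) j) ℤ.* + suc l
      ≡⟨ regroup (s m (j ℕ.+ l)) (S j k) (binomial (suc (j ℕ.+ l)) j) (+ suc l) ⟩
    s m (j ℕ.+ l) ℤ.* S j k ℤ.* (+ suc l ℤ.* binomial (suc (j ℕ.+ l)) j)
      ≡⟨ cong (s m (j ℕ.+ l) ℤ.* S j k ℤ.*_) ([l+1]*binomial[j+l+1,j]≡[j+l+1]*binomial[j+l,j] j l) ⟩
    s m (j ℕ.+ l) ℤ.* S j k ℤ.* (+ suc (j ℕ.+ l) ℤ.* binomial (j ℕ.+ l) j)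
      ≡⟨ regroup′ (s m (j ℕ.+ l)) (S j k) (+ suc (j ℕ.+ l)) (binomial (j ℕ.+ l) j) ⟩
    S j k ℤ.* V m j l ℤ.* + suc (j ℕ.+ l) ∎)
  beyond : ∀ j l → m ∸ j < l → (S j k ℤ.* V m j l) / suc l ≡ 0ℚ
  beyond j l m∸j<l = trans (cong (_/ suc l) vanish) (ℚ.0/n≡0 (suc l))
    where
    m<j+l : m < j ℕ.+ l
    m<j+l = ℕ.≤-<-trans (ℕ.m≤n+m∸n m j) (ℕ.+-monoʳ-< j m∸j<l)
    vanish : S j k ℤ.* V m j l ≡ 0ℤ
    vanish = trans (cong (λ x → S j k ℤ.* (x ℤ.* binomial (j ℕ.+ l) j)) (n<k⇒stirling1≡0 m<j+l))
                   (ℤ.*-zeroʳ (S j k))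

[k+1]*∑stirling1*stirling2/[p+1]≡binomial*bernoulli2 : ∀ m k →
  (+ suc k / 1) * (∑[ p ≤ m ] (stirling1 m p ℤ.* stirling2 (suc p) (suc k)) / suc p) ≡
  (binomial m k / 1) * bernoulli2 (m ∸ k)
[k+1]*∑stirling1*stirling2/[p+1]≡binomial*bernoulli2 m k = begin
  (+ suc k / 1) * (∑[ p ≤ m ] (stirling1 m p ℤ.* stirling2 (suc p) (suc k)) / suc p)
    ≡⟨ [k+1]*∑stirling1*stirling2/[p+1]≡∑monomialCoeff m k ⟩
  ∑[ l ≤ m ] (ℤ∑.∑[ j ≤ m ] stirling2 j k ℤ.* monomialCoeff m j l) / suc l
    ≡⟨ ∑-cong m (λ l → cong (_/ suc l) (∑stirling2*monomialCoeff≡fallingCoeff ℕ.≤-refl k l)) ⟩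
  ∑[ l ≤ m ] (c ℤ.* stirling1 d l) / suc l
    ≡⟨ ∑-extend (λ l → (c ℤ.* stirling1 d l) / suc l) (ℕ.m∸n≤m m k) beyond ⟩
  ∑[ l ≤ d ] (c ℤ.* stirling1 d l) / suc l
    ≡⟨ ∑-cong d (λ l → sym ([a/1]*[b/n]≡[a*b]/n c (stirling1 d l) l)) ⟩
  ∑[ l ≤ d ] (c / 1) * (stirling1 d l / suc l)
    ≡⟨ sym (*-distribˡ-∑ d (c / 1) (λ l → stirling1 d l / suc l)) ⟩
  (c / 1) * (∑[ l ≤ d ] stirling1 d l / suc l)
    ≡⟨ cong ((c / 1) *_) (sym (sumTo≡∑ d (λ l → stirling1 d l / suc l))) ⟩
  (c / 1) * bernoulli2 d ∎
  where
  c = binomial m k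
  d = m ∸ k
  beyond : ∀ l → d < l → (c ℤ.* stirling1 d l) / suc l ≡ 0ℚ
  beyond l d<l = trans (cong (λ x → (c ℤ.* x) / suc l) (n<k⇒stirling1≡0 d<l))
                       (trans (cong (_/ suc l) (ℤ.*-zeroʳ c)) (ℚ.0/n≡0 (suc l)))

theorem4 : (n k : ℕ) → 1 ≤ k → k ≤ n →
    sumFromTo k n (summand n k) ≡ rhs n k
theorem4 (suc m) (suc k) _ (s≤s k≤m) = begin
  sumFromTo (suc k) (suc m) (summand (suc m) (suc k))
    ≡⟨ sumFromTo≡∑ (summand (suc m) (suc k)) (s≤s k≤m) (summand≡0 (suc m) (suc k)) ⟩
  ∑≤ (suc m) (summand (suc m) (suc k))
    ≡⟨ trans (∑-suc m (summand (suc m) (suc k))) (ℚ.+-identityˡ _) ⟩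
  ∑[ p ≤ m ] (stirling1 m p ℤ.* stirling2 (suc p) (suc k)) / suc p
    ≡⟨ [k+1]*x≡a*y⇒x≡[a/[k+1]]*y k (binomial m k) ([k+1]*∑stirling1*stirling2/[p+1]≡binomial*bernoulli2 m k) ⟩
  (binomial m k / suc k) * bernoulli2 (m ∸ k)
    ≡⟨ cong (_* bernoulli2 (m ∸ k)) (binomial[m,k]/[k+1]≡[m+1]C[k+1]/[m+1] m k) ⟩
  rhs (suc m) (suc k) ∎
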